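{- Let $z\in\mathfrak F_\infty$ and let $w^1w^2\cdots w^m\in\mathrm{RF}^m_{\mathsf{FPF}}(z)$ be an increasing factorization of $w\in\hat{\mathcal R}_{\mathsf{FPF}}(z)$. The odd operator $\tilde e^F_{\bar1}=(\mathrm H'_{\mathsf{Sp}})^{ -1}\circ(\mathrm{id},\tilde e^P_{\bar1})\circ\mathrm H'_{\mathsf{Sp}}$ acts as follows; whenever $\tilde e^F_{\bar1}(w^1\cdots w^m)\ne\mathbf0$ it changes only the first two factors, producing $\tilde w^1\tilde w^2w^3\cdots w^m$. (1) If $|w^2|=0$, then $\tilde e^F_{\bar1}(w^1\cdots w^m)=\mathbf0$. (2) If $|w^1|=0$ and $|w^2|\ne0$, then $\tilde w^1=v_1$ and $\mathrm{cont}(\tilde w^2)=\mathrm{cont}(w^2)\setminus\{v_1\}$, where $v_1$ is the first letter of $w^2$. (3) If $|w^1|\ne0$ and $|w^2|\ne0$, write $w^1=u_1u_2\cdots$ and $w^2=v_1\cdots$. If $u_1>v_1+1$, then $\mathrm{cont}(\tilde w^1)=\mathrm{cont}(w^1)\cup\{v_1\}$ and $\mathrm{cont}(\tilde w^2)=\mathrm{cont}(w^2)\setminus\{v_1\}$. If $u_1=v_1+1$, then $\mathrm{cont}(\tilde w^1)=\mathrm{cont}(w^1)\cup\{u_1+1\}$ and $\mathrm{cont}(\tilde w^2)=\mathrm{cont}(w^2)\setminus\{u_1-1\}$. Otherwise $\tilde e^F_{\bar1}(w^1\cdots w^m)=\mathbf0$.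
   Context: Let $s_i$ be the simple transposition $(i\ i{+}1)$, $\mathfrak S_\infty$ the finitely supported permutations of $\{1,2,\dots\}$, $\Theta=(1\,2)(3\,4)\cdots$, $\mathfrak F_\infty=\{\pi^{ -1}\Theta\pi:\pi\in\mathfrak S_\infty\}$. For $z\in\mathfrak F_\infty$, $\hat{\mathcal R}_{\mathsf{FPF}}(z)$ is the set of FPF-involution words for $z$: words $i_1\cdots i_l$ of positive integers with $z=s_{i_l}\cdots s_{i_1}\Theta s_{i_1}\cdots s_{i_l}$ and $l$ minimal. An increasing factorization with $m$ blocks of $w$ is a sequence $w^1\cdots w^m$ of strictly increasing (possibly empty) words concatenating to $w$; $\mathrm{RF}^m_{\mathsf{FPF}}(z)$ is the set of these for all $w\in\hat{\mathcal R}_{\mathsf{FPF}}(z)$. $\mathrm{cont}(u)$ is the set of letters of $u$; a strictly increasing word is determined by its content. Shifted diagram of strict $\lambda$: $S(\lambda)=\{(i,j):1\le i\le\ell(\lambda),\ i\le j\le\lambda_i+i-1\}$ (rows, columns, main diagonal $(i,i)$). An increasing shifted tableau: filling of $S(\lambda)$ by positive integers strictly increasing along rows and down columns; $T_{(i,j)}$ is the entry at $(i,j)$. A primed tableau with entries $\le m$: filling of $S(\lambda)$ by letters from $1'<1<2'<2<\cdots<m'<m$, weakly increasing along rows and columns, with at most one $i'$ in each row, at most one unprimed $i$ in each column, and no primed letters on the main diagonal. FPF-involution Coxeter–Knuth insertion: to insert letter $a$ into increasing shifted tableau $T$, insert $a$ into the first row, where inserting $x$ into a row or column $L$ means: let $b$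 be the smallest entry of $L$ with $x\le b$; if none, append $x$ at the end of $L$ and stop; otherwise (1) if $x=b$, leave $L$ unchanged and insert $x+1$ into the row below (if $L$ is a row) or the next column to the right (if $L$ is a column); (2) if $L$ is a row, $b$ is its first entry and $x\not\equiv b\pmod2$, leave $L$ unchanged and insert $x+2$ into the next column to the right; (3) otherwise replace $b$ by $x$ and insert $b$ into the row below if $L$ is a row, or into the next column to the right if $L$ is a column or $b$ was on the main diagonal. For $w=u_1\cdots u_l$, insert $u_1,\dots,u_l$ successively into the empty tableau; $P_{\mathsf{Sp}}(w)$ is the final tableau, and $Q_{\mathsf{Sp}}(w)$ records, for each $k$, a box at the position where the insertion of $u_k$ terminated, with entry $k$ if it terminated with a row insertion and $k'$ if with a column insertion. For an increasing factorization $w^1\cdots w^m$ of $w$, $Q_{\mathsf{Sp}}(w^1\cdots w^m)$ is obtained from $Q_{\mathsf{Sp}}(w)$ by replacing each entry created while inserting a letter of $w^i$ by $i$ if unprimed and by $i'$ if primed. The map $\mathrm H'_{\mathsf{Sp}}:w^1\cdots w^m\mapsto(P_{\mathsf{Sp}}(w),Q_{\mathsf{Sp}}(w^1\cdots w^m))$ is (by a theorem of Marberg) a bijection from $\mathrm{RF}^m_{\mathsf{FPF}}(z)$ onto pairs $(P,Q)$ with $P$ increasing shifted, $\mathfrak{row}(P)\in\hat{\mathcal R}_{\mathsf{FPF}}(z)$ (row reading word: rows read left to right, from the last row to the first), and $Q$ a primed tableau with entries $\le m$ of the same shape. The operator $\tilde e^P_{\bar1}$ on primed tableaux $Q$: if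 $Q_{(1,1)}=2$, change it to $1$; if $Q_{(1,i)}=2'$ for some $i\ge2$, change it to $1$; otherwise $\tilde e^P_{\bar1}Q=\mathbf0$. The composite $(\mathrm H'_{\mathsf{Sp}})^{ -1}\circ(\mathrm{id},\tilde e^P_{\bar1})\circ\mathrm H'_{\mathsf{Sp}}$ is $\mathbf0$ when $\tilde e^P_{\bar1}Q=\mathbf0$. -}

module Defs where

open import Data.Nat using (ℕ; zero; suc; _+_; _*_; _∸_; _≤_; _<_; _≡ᵇ_; _≤ᵇ_; _%_)
open import Data.Bool using (Bool; true; false; if_then_else_; _∧_; not)
open import Data.List using (List; []; _∷_; _++_; foldl; length; map; concat; drop)
open import Data.Nat.ListAction using (sum)
open import Data.List.Relation.Unary.All using (All)
open import Data.List.Relation.Unary.Linked using (Linked)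
open import Data.List.Membership.Propositional using (_∈_)
open import Data.Maybe using (Maybe; just; nothing)
import Data.Maybe as M
open import Data.Product using (_×_; _,_; Σ; ∃; ∃₂; proj₁; proj₂)
open import Data.Sum using (_⊎_; inj₁; inj₂)
open import Relation.Binary.PropositionalEquality using (_≡_; _≢_)
open import Function.Bundles using (_⇔_)

-- Permutations of {1,2,...}, represented as functions ℕ → ℕ
-- (the value 0 is a dummy point fixed by everything below).

s : ℕ → ℕ → ℕ
s i n = if n ≡ᵇ i then suc i else (if n ≡ᵇ suc i then i else n)

-- Θ = (1 2)(3 4)(5 6)...
Θ : ℕ → ℕ
Θ zero = zero
Θ (suc n) = if n % 2 ≡ᵇ 0 then suc (suc n) else n

-- conjW (i₁ ⋯ iₗ) = s_{iₗ} ⋯ s_{i₁} Θ s_{i₁} ⋯ s_{iₗ}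
conjW : List ℕ → ℕ → ℕ
conjW w = foldl (λ z i → λ n → s i (z (s i n))) Θ w

Positive : List ℕ → Set
Positive w = All (λ a → 1 ≤ a) w

-- z ∈ 𝔉_∞ : z = π⁻¹ Θ π with π ∈ 𝔖_∞ (π a product of simple transpositions)
InF∞ : (ℕ → ℕ) → Set
InF∞ z = ∃ λ w → Positive w × (∀ n → conjW w n ≡ z n)

IsFPFWord : (ℕ → ℕ) → List ℕ → Set
IsFPFWord z w =
  Positive w × (∀ n → conjW w n ≡ z n) ×
  (∀ w' → Positive w' → (∀ n → conjW w' n ≡ z n) → length w ≤ length w')

IsRF : ℕ → (ℕ → ℕ) → List (List ℕ) → Set
IsRF m z f = length f ≡ m × All (Linked _<_) f × IsFPFWord z (concat f)

-- i-th factor (0-indexed; [] if absent)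
rowAt : {A : Set} → List (List A) → ℕ → List A
rowAt [] _ = []
rowAt (r ∷ rs) zero = r
rowAt (r ∷ rs) (suc k) = rowAt rs k

-- Shifted tableaux as lists of rows; row r (0-indexed) occupies the
-- (0-indexed) columns r, r+1, ..., r + length(row) - 1.

Tab : Set
Tab = List (List ℕ)

-- primed tableau: entries (n , primed?)
QTab : Set
QTab = List (List (ℕ × Bool))

appendAt : {A : Set} → List (List A) → ℕ → A → List (List A)
appendAt [] _ x = (x ∷ []) ∷ []
appendAt (r ∷ rs) zero x = (r ++ x ∷ []) ∷ rs
appendAt (r ∷ rs) (suc k) x = r ∷ appendAt rs k x

setAt : {A : Set} → List A → ℕ → A → List A
setAt [] _ _ = []
setAt (a ∷ as) zero x = x ∷ as
setAt (a ∷ as) (suc k) x = a ∷ setAt as k x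

setEntry : Tab → ℕ → ℕ → ℕ → Tab
setEntry [] _ _ _ = []
setEntry (r ∷ rs) zero k x = setAt r k x ∷ rs
setEntry (r ∷ rs) (suc i) k x = r ∷ setEntry rs i k x

entryAt : List ℕ → ℕ → Maybe ℕ
entryAt [] _ = nothing
entryAt (a ∷ as) zero = just a
entryAt (a ∷ as) (suc k) = entryAt as k

findRow : ℕ → List ℕ → Maybe (ℕ × ℕ)
findRow x [] = nothing
findRow x (b ∷ bs) =
  if x ≤ᵇ b then just (0 , b) else M.map (λ p → (suc (proj₁ p) , proj₂ p)) (findRow x bs)

-- scanning column c from the top (rows r, r+1, ...):
-- inj₂ (i , b): first entry b ≥ x in column c, located in row i;
-- inj₁ i      : no such entry; i is the row just below the end of column c.
mutual
  colFind : ℕ → ℕ → ℕ → Tab → ℕ ⊎ (ℕ × ℕ)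
  colFind x c r [] = inj₁ r
  colFind x c r (row ∷ rows) =
    if r ≤ᵇ c then colFindE x c r rows (entryAt row (c ∸ r)) else inj₁ r

  colFindE : ℕ → ℕ → ℕ → Tab → Maybe ℕ → ℕ ⊎ (ℕ × ℕ)
  colFindE x c r rows nothing = inj₁ r
  colFindE x c r rows (just e) =
    if x ≤ᵇ e then inj₂ (r , e) else colFind x c (suc r) rows

-- Result: new tableau, row in which the new box was created (it is always
-- created at the end of that row), and whether insertion terminated with a
-- column insertion (true = primed).
Res : Set
Res = Tab × ℕ × Bool

mutual
  insRow : ℕ → ℕ → ℕ → Tab → Res
  insRow zero x r T = (T , 0 , false)
  insRow (suc n) x r T = insRowF n x r T (findRow x (rowAt T r))

  insRowF : ℕ → ℕ → ℕ → Tab → Maybe (ℕ × ℕ) → Res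
  insRowF n x r T nothing = (appendAt T r x , r , false)
  insRowF n x r T (just (k , b)) =
    if x ≡ᵇ b then insRow n (suc x) (suc r) T
    else (if (k ≡ᵇ 0) ∧ not (x % 2 ≡ᵇ b % 2)
          then insCol n (suc (suc x)) (suc r) T
          else (if k ≡ᵇ 0
                then insCol n b (suc r) (setEntry T r k x)   -- b was on the main diagonal
                else insRow n b (suc r) (setEntry T r k x)))

  insCol : ℕ → ℕ → ℕ → Tab → Res
  insCol zero x c T = (T , 0 , false)
  insCol (suc n) x c T = insColF n x c T (colFind x c 0 T)

  insColF : ℕ → ℕ → ℕ → Tab → ℕ ⊎ (ℕ × ℕ) → Res
  insColF n x c T (inj₁ i) = (appendAt T i x , i , true)
  insColF n x c T (inj₂ (i , b)) =
    if x ≡ᵇ b then insCol n (suc x) (suc c) T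
    else insCol n b (suc c) (setEntry T i (c ∸ i) x)

-- fuel: more than enough steps (each step moves one row down or one column
-- right; at most #rows+1 row steps and (#entries+2) column steps)
fuel : Tab → ℕ
fuel T = 5 + 3 * (sum (map length T) + length T)

insertP : Tab → ℕ → Res
insertP T a = insRow (fuel T) a 0 T

step : ℕ → Tab × QTab → ℕ → Tab × QTab
step i (P , Q) a with insertP P a
... | (P' , r , pr) = (P' , appendAt Q r (i , pr))

goH : ℕ → List (List ℕ) → Tab × QTab → Tab × QTab
goH i [] acc = acc
goH i (u ∷ us) acc = goH (suc i) us (foldl (step i) acc u)

-- H'_Sp (w¹ ⋯ wᵐ) = (P_Sp(w) , Q_Sp(w¹ ⋯ wᵐ))  (factors numbered from 1)
HSp : List (List ℕ) → Tab × QTab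
HSp f = goH 1 f ([] , [])

-- the operator ẽ^P_{1̄} on primed tableaux (nothing = 𝟎)

fix2' : List (ℕ × Bool) → Maybe (List (ℕ × Bool))
fix2' [] = nothing
fix2' ((n , p) ∷ xs) =
  if (n ≡ᵇ 2) ∧ p then just ((1 , false) ∷ xs) else M.map ((n , p) ∷_) (fix2' xs)

eP : QTab → Maybe QTab
eP [] = nothing
eP ([] ∷ rows) = nothing
eP (((n , p) ∷ rest) ∷ rows) =
  if (n ≡ᵇ 2) ∧ not p then just (((1 , false) ∷ rest) ∷ rows)
  else M.map (λ rest' → ((n , p) ∷ rest') ∷ rows) (fix2' rest)

-- ẽ^F_{1̄} = (H'_Sp)⁻¹ ∘ (id , ẽ^P_{1̄}) ∘ H'_Sp

EFZero : List (List ℕ) → Set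
EFZero f = eP (proj₂ (HSp f)) ≡ nothing

-- ẽ^F_{1̄} f = g  (g is the element of RF^m_FPF(z) mapped by H'_Sp to (P , ẽ^P_{1̄} Q))
EFis : (ℕ → ℕ) → ℕ → List (List ℕ) → List (List ℕ) → Set
EFis z m f g =
  IsRF m z g ×
  Σ QTab (λ Q' → eP (proj₂ (HSp f)) ≡ just Q' × HSp g ≡ (proj₁ (HSp f) , Q'))

EFform : (ℕ → ℕ) → ℕ → List (List ℕ) → (ℕ → Set) → (ℕ → Set) → Set
EFform z m f C1 C2 =
  ∃₂ λ (w1 w2 : List ℕ) → EFis z m f (w1 ∷ w2 ∷ drop 2 f) ×
     (∀ a → (a ∈ w1) ⇔ C1 a) × (∀ a → (a ∈ w2) ⇔ C2 a)

module Submission where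

-- ẽ^P_{1̄} only looks at row 0 of Q = Q_Sp(f): it acts iff that row starts with
-- an unprimed 2 or contains a primed 2 further right.  Only the first two
-- factors can create such entries, so the proof runs the insertion algorithm
-- explicitly on them.

open import Defs
open import Data.Nat using (ℕ; zero; suc; _*_; _∸_; _≤_; _<_; _≡ᵇ_; _≤ᵇ_; _%_; z≤n; s≤s; s<s⁻¹)
open import Data.Nat.Properties
open import Data.Nat.DivMod using (m*n%n≡0)
open import Data.Bool using (Bool; true; false; T)
open import Data.List using (List; []; _∷_; _++_; foldl; length; map; concat; drop)
open import Data.List.Properties using (++-assoc; length-++; ++-identityʳ)
open import Data.List.Relation.Unary.All using (All; []; _∷_)
import Data.List.Relation.Unary.All as All
import Data.List.Relation.Unary.All.Properties as AllP
open import Data.List.Relation.Unary.AllPairs using (AllPairs; []; _∷_)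
import Data.List.Relation.Unary.AllPairs.Properties as AllPairsP
open import Data.List.Relation.Unary.Any using (here; there)
open import Data.List.Relation.Unary.Linked using (Linked; []; [-]; _∷_)
import Data.List.Relation.Unary.Linked as Linked
open import Data.List.Relation.Unary.Linked.Properties using (Linked⇒AllPairs)
open import Data.List.Membership.Propositional using (_∈_)
open import Data.Maybe using (just; nothing)
open import Data.Product using (_×_; _,_; Σ; ∃₂; proj₁; proj₂)
open import Data.Sum using (_⊎_; inj₁; inj₂; [_,_]′)
open import Data.Empty using (⊥; ⊥-elim)
open import Data.Unit using (⊤; tt)
open import Function.Bundles using (_⇔_; mk⇔)
open import Relation.Nullary using (yes; no)
open import Relation.Binary.PropositionalEquality

≡ᵇ-refl : ∀ m → (m ≡ᵇ m) ≡ true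
≡ᵇ-refl zero = refl
≡ᵇ-refl (suc m) = ≡ᵇ-refl m

≡ᵇ-false : ∀ {m n} → m ≢ n → (m ≡ᵇ n) ≡ false
≡ᵇ-false {m} {n} m≢n with m ≡ᵇ n in eq
... | true = ⊥-elim (m≢n (≡ᵇ⇒≡ m n (subst T (sym eq) tt)))
... | false = refl

≤ᵇ-true : ∀ {m n} → m ≤ n → (m ≤ᵇ n) ≡ true
≤ᵇ-true {m} {n} m≤n with m ≤ᵇ n in eq
... | true = refl
... | false = ⊥-elim (subst T eq (≤⇒≤ᵇ m≤n))

≤ᵇ-false : ∀ {m n} → n < m → (m ≤ᵇ n) ≡ false
≤ᵇ-false {m} {n} n<m with m ≤ᵇ n in eq
... | false = refl
... | true = ⊥-elim (<⇒≱ n<m (≤ᵇ⇒≤ m n (subst T (sym eq) tt)))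

n≢1+n : ∀ n → n ≢ suc n
n≢1+n n = <⇒≢ (n<1+n n)

n≢2+n : ∀ n → n ≢ suc (suc n)
n≢2+n n = <⇒≢ (m<n⇒m<1+n (n<1+n n))

n≢3+n : ∀ n → n ≢ suc (suc (suc n))
n≢3+n n = <⇒≢ (m<n⇒m<1+n (m<n⇒m<1+n (n<1+n n)))

s-left : ∀ i → s i i ≡ suc i
s-left i rewrite ≡ᵇ-refl i = refl

s-right : ∀ i → s i (suc i) ≡ i
s-right i rewrite ≡ᵇ-false (≢-sym (n≢1+n i)) | ≡ᵇ-refl i = refl

s-fix : ∀ {i n} → n ≢ i → n ≢ suc i → s i n ≡ n
s-fix n≢i n≢1+i rewrite ≡ᵇ-false n≢i | ≡ᵇ-false n≢1+i = refl

s-invol : ∀ i n → s i (s i n) ≡ n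
s-invol i n with n ≟ i | n ≟ suc i
... | yes refl | _ rewrite s-left i = s-right i
... | no _ | yes refl rewrite s-right i = s-left i
... | no n≢i | no n≢1+i rewrite s-fix n≢i n≢1+i = s-fix n≢i n≢1+i

-- When u ≥ v + 2 the supports {v, v+1} and {u, u+1} are disjoint, so s u and
-- s v commute.
module DisjointSupports {u v : ℕ} (gap : suc (suc v) ≤ u) where
  u-fixes-v : s u v ≡ v
  u-fixes-v = s-fix (<⇒≢ (≤-trans (n≤1+n _) gap)) (<⇒≢ (≤-trans (n≤1+n _) (≤-trans gap (n≤1+n u))))

  u-fixes-1+v : s u (suc v) ≡ suc v
  u-fixes-1+v = s-fix (<⇒≢ gap) (<⇒≢ (≤-trans gap (n≤1+n u)))

  v-fixes-u : s v u ≡ u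
  v-fixes-u = s-fix (>⇒≢ (≤-trans (n≤1+n _) gap)) (>⇒≢ gap)

  v-fixes-1+u : s v (suc u) ≡ suc u
  v-fixes-1+u = s-fix (>⇒≢ (≤-trans (n≤1+n _) (≤-trans gap (n≤1+n u)))) (>⇒≢ (≤-trans gap (n≤1+n u)))

  commute : ∀ n → s u (s v n) ≡ s v (s u n)
  commute n with n ≟ v | n ≟ suc v | n ≟ u | n ≟ suc u
  ... | yes refl | _ | _ | _ rewrite s-left v | u-fixes-1+v | u-fixes-v = sym (s-left v)
  ... | no _ | yes refl | _ | _ rewrite s-right v | u-fixes-1+v | u-fixes-v = sym (s-right v)
  ... | no _ | no _ | yes refl | _ rewrite v-fixes-u | s-left u | v-fixes-1+u = refl
  ... | no _ | no _ | no _ | yes refl rewrite v-fixes-1+u | s-right u | v-fixes-u = refl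
  ... | no n≢v | no n≢1+v | no n≢u | no n≢1+u
    rewrite s-fix n≢v n≢1+v | s-fix n≢u n≢1+u | s-fix n≢v n≢1+v = refl

s-comm : ∀ {u v} → suc (suc v) ≤ u → ∀ n → s u (s v n) ≡ s v (s u n)
s-comm gap = DisjointSupports.commute gap

parity : ∀ n → (Σ ℕ λ t → n ≡ t * 2) ⊎ (Σ ℕ λ t → n ≡ suc (t * 2))
parity zero = inj₁ (0 , refl)
parity (suc n) with parity n
... | inj₁ (t , refl) = inj₂ (t , refl)
... | inj₂ (t , refl) = inj₁ (suc t , refl)

odd%2 : ∀ t → suc (t * 2) % 2 ≡ 1
odd%2 zero = refl
odd%2 (suc t) = odd%2 t

Θ-odd : ∀ t → Θ (suc (t * 2)) ≡ suc (suc (t * 2))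
Θ-odd t rewrite m*n%n≡0 t 2 {{_}} = refl

Θ-even : ∀ t → Θ (suc (suc (t * 2))) ≡ suc (t * 2)
Θ-even t rewrite odd%2 t = refl

Θ-invol : ∀ n → Θ (Θ n) ≡ n
Θ-invol zero = refl
Θ-invol (suc n) with parity n
... | inj₁ (t , refl) rewrite Θ-odd t = Θ-even t
... | inj₂ (t , refl) rewrite Θ-even t = Θ-odd t

Θ-injective : ∀ {m n} → Θ m ≡ Θ n → m ≡ n
Θ-injective {m} {n} e = trans (sym (Θ-invol m)) (trans (cong Θ e) (Θ-invol n))

Θ-avoids : ∀ {n k y} → n ≢ k → Θ k ≡ y → Θ n ≢ y
Θ-avoids n≢k Θk≡y Θn≡y = n≢k (Θ-injective (trans Θn≡y (sym Θk≡y)))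

-- Conjugation of g by s i; by definition conjW w = foldl conjBy Θ w.
conjBy : (ℕ → ℕ) → ℕ → ℕ → ℕ
conjBy g i n = s i (g (s i n))

conjBy-cong : ∀ {g h} i → g ≗ h → conjBy g i ≗ conjBy h i
conjBy-cong i g≗h n = cong (s i) (g≗h _)

conjAll-cong : ∀ {g h} w → g ≗ h → foldl conjBy g w ≗ foldl conjBy h w
conjAll-cong [] g≗h = g≗h
conjAll-cong (i ∷ w) g≗h = conjAll-cong w (conjBy-cong i g≗h)

conjBy-cancel : ∀ g i → conjBy (conjBy g i) i ≗ g
conjBy-cancel g i n rewrite s-invol i n = s-invol i _

conjBy-comm : ∀ {u v} g → suc (suc v) ≤ u → conjBy (conjBy g u) v ≗ conjBy (conjBy g v) u
conjBy-comm g gap n rewrite s-comm gap n = sym (s-comm gap (g _))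

move-to-front : ∀ g v U rest → All (λ u → suc (suc v) ≤ u) U →
  foldl conjBy g (U ++ v ∷ rest) ≗ foldl conjBy (conjBy g v) (U ++ rest)
move-to-front g v [] rest [] n = refl
move-to-front g v (u ∷ U) rest (gap ∷ gaps) n =
  trans (move-to-front (conjBy g u) v U rest gaps n) (conjAll-cong (U ++ rest) (conjBy-comm g gap) n)

conjBy-odd : ∀ t → conjBy Θ (suc (t * 2)) ≗ Θ
conjBy-odd t n with n ≟ suc (t * 2) | n ≟ suc (suc (t * 2))
... | yes refl | _ rewrite s-left (suc (t * 2)) | Θ-even t = trans (s-left _) (sym (Θ-odd t))
... | no _ | yes refl rewrite s-right (suc (t * 2)) | Θ-odd t = trans (s-right _) (sym (Θ-even t))
... | no n≢c | no n≢a rewrite s-fix n≢c n≢a =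
  s-fix (Θ-avoids n≢a (Θ-even t)) (Θ-avoids n≢c (Θ-odd t))

-- Let c, a = c+1, b = c+2, d = c+3 with Θ pairing c↔a and b↔d.
-- Then Z = s_a Θ s_a pairs c↔b, a↔d, and conjugating Z by s_c or by s_b gives
-- the same involution pairing c↔d, a↔b.
module FPFRelation (c : ℕ) (Θc : Θ c ≡ suc c) (Θa : Θ (suc c) ≡ c)
                   (Θb : Θ (suc (suc c)) ≡ suc (suc (suc c))) (Θd : Θ (suc (suc (suc c))) ≡ suc (suc c)) where
  a b d : ℕ
  a = suc c
  b = suc a
  d = suc b

  Z : ℕ → ℕ
  Z = conjBy Θ a

  Zc : Z c ≡ b
  Zc rewrite s-fix {a} {c} (n≢1+n c) (n≢2+n c) | Θc = s-left a

  Za : Z a ≡ d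
  Za rewrite s-left a | Θb = s-fix {a} {d} (≢-sym (n≢2+n a)) (≢-sym (n≢1+n b))

  Zb : Z b ≡ c
  Zb rewrite s-right a | Θa = s-fix {a} {c} (n≢1+n c) (n≢2+n c)

  Zd : Z d ≡ a
  Zd rewrite s-fix {a} {d} (≢-sym (n≢2+n a)) (≢-sym (n≢1+n b)) | Θd = s-right a

  relation : conjBy Z c ≗ conjBy Z b
  relation n with n ≟ c | n ≟ a | n ≟ b | n ≟ d
  ... | yes refl | _ | _ | _
    rewrite s-left c | Za | s-fix {c} {d} (≢-sym (n≢3+n c)) (≢-sym (n≢2+n a)) | s-fix {b} {c} (n≢2+n c) (n≢3+n c) | Zc
    = sym (s-left b)
  ... | no _ | yes refl | _ | _
    rewrite s-right c | Zc | s-fix {c} {b} (≢-sym (n≢2+n c)) (≢-sym (n≢1+n a)) | s-fix {b} {a} (n≢1+n a) (n≢2+n a) | Za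
    = sym (s-right b)
  ... | no _ | no _ | yes refl | _
    rewrite s-fix {c} {b} (≢-sym (n≢2+n c)) (≢-sym (n≢1+n a)) | Zb | s-left c | s-left b | Zd
    = sym (s-fix {b} {a} (n≢1+n a) (n≢2+n a))
  ... | no _ | no _ | no _ | yes refl
    rewrite s-fix {c} {d} (≢-sym (n≢3+n c)) (≢-sym (n≢2+n a)) | Zd | s-right c | s-right b | Zb
    = sym (s-fix {b} {c} (n≢2+n c) (n≢3+n c))
  ... | no n≢c | no n≢a | no n≢b | no n≢d =
    begin
      s c (Z (s c n)) ≡⟨ cong (λ x → s c (Z x)) (s-fix n≢c n≢a) ⟩
      s c (Z n)       ≡⟨ cong (s c) Zn ⟩
      s c (Θ n)       ≡⟨ s-fix (Θ-avoids n≢a Θa) (Θ-avoids n≢c Θc) ⟩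
      Θ n             ≡⟨ sym (s-fix (Θ-avoids n≢d Θd) (Θ-avoids n≢b Θb)) ⟩
      s b (Θ n)       ≡⟨ cong (s b) (sym Zn) ⟩
      s b (Z n)       ≡⟨ cong (λ x → s b (Z x)) (sym (s-fix n≢b n≢d)) ⟩
      s b (Z (s b n)) ∎
    where
      open ≡-Reasoning
      Zn : Z n ≡ Θ n
      Zn = trans (cong (λ x → s a (Θ x)) (s-fix n≢a n≢b))
                 (s-fix (Θ-avoids n≢c Θc) (Θ-avoids n≢d Θd))

fpf-relation : ∀ t → conjBy (conjBy Θ (suc (suc (t * 2)))) (suc (t * 2))
                   ≗ conjBy (conjBy Θ (suc (suc (t * 2)))) (suc (suc (suc (t * 2))))
fpf-relation t = FPFRelation.relation (suc (t * 2)) (Θ-odd t) (Θ-even t) (Θ-odd (suc t)) (Θ-even (suc t))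

not-shorter : ∀ {z w w'} → IsFPFWord z w → Positive w' → conjW w' ≗ conjW w → length w' < length w → ⊥
not-shorter (_ , w↦z , minimal) pos' w'≗w shorter =
  <⇒≱ shorter (minimal _ pos' (λ n → trans (w'≗w n) (w↦z n)))

same-length-FPF : ∀ {z w w'} → IsFPFWord z w → Positive w' → conjW w' ≗ conjW w → length w' ≡ length w →
  IsFPFWord z w'
same-length-FPF (_ , w↦z , minimal) pos' w'≗w same =
  pos' , (λ n → trans (w'≗w n) (w↦z n)) ,
  λ w'' pos'' w''↦z → subst (_≤ length w'') (sym same) (minimal w'' pos'' w''↦z)

length-insert : ∀ (U : List ℕ) v rest → length (U ++ v ∷ rest) ≡ suc (length (U ++ rest))
length-insert [] v rest = refl
length-insert (u ∷ U) v rest = cong suc (length-insert U v rest)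

positive-remove : ∀ U {v rest} → Positive (U ++ v ∷ rest) → Positive (U ++ rest)
positive-remove U pos with AllP.++⁻ U pos
... | posU , (_ ∷ posRest) = AllP.++⁺ posU posRest

positive-to-front : ∀ U {v rest} → Positive (U ++ v ∷ rest) → Positive (v ∷ U ++ rest)
positive-to-front U pos with AllP.++⁻ U pos
... | posU , (posV ∷ posRest) = posV ∷ AllP.++⁺ posU posRest

-- An odd letter 2t+1 preceded only by letters ≥ 2t+3 commutes to the front,
-- where it fixes Θ; so it never occurs in an FPF-involution word.  (With U = []
-- this says that such words start with an even letter.)
odd-letter-redundant : ∀ {z t} U rest → All (λ u → suc (suc (suc (t * 2))) ≤ u) U →
  IsFPFWord z (U ++ suc (t * 2) ∷ rest) → ⊥
odd-letter-redundant {t = t} U rest gaps W@(pos , _) =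
  not-shorter W (positive-remove U pos)
    (λ n → sym (trans (move-to-front Θ (suc (t * 2)) U rest gaps n) (conjAll-cong (U ++ rest) (conjBy-odd t) n)))
    (≤-reflexive (sym (length-insert U _ rest)))

-- For even a = 2t+2 a word a (a+1) U (a−1) ⋯ with U ≥ a+1 is not reduced:
-- after moving a−1 to the front, the FPF relation turns it into a+1, which cancels.
ladder-redundant : ∀ {z t} U rest → All (λ u → suc (suc (suc (t * 2))) ≤ u) U →
  IsFPFWord z (suc (suc (t * 2)) ∷ suc (suc (suc (t * 2))) ∷ U ++ suc (t * 2) ∷ rest) → ⊥
ladder-redundant {t = t} U rest gaps W@(posA ∷ _ ∷ pos , _) =
  not-shorter W (posA ∷ positive-remove U pos) equivalent
    (s≤s (m<n⇒m<1+n (≤-reflexive (sym (length-insert U _ rest)))))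
  where
    a c : ℕ
    a = suc (suc (t * 2))
    c = suc (t * 2)
    cancel : conjBy (conjBy (conjBy Θ a) (suc a)) c ≗ conjBy Θ a
    cancel k = trans (conjBy-cong c (λ j → sym (fpf-relation t j)) k) (conjBy-cancel (conjBy Θ a) c k)
    equivalent : conjW (a ∷ U ++ rest) ≗ conjW (a ∷ suc a ∷ U ++ c ∷ rest)
    equivalent n = sym (trans (move-to-front (conjBy (conjBy Θ a) (suc a)) c U rest gaps n)
                              (conjAll-cong (U ++ rest) cancel n))

-- The rearrangement of case (3a): v moves to the front past letters ≥ v+2.
front-FPF : ∀ {z} v U rest → All (λ u → suc (suc v) ≤ u) U →
  IsFPFWord z (U ++ v ∷ rest) → IsFPFWord z (v ∷ U ++ rest)
front-FPF v U rest gaps W@(pos , _) =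
  same-length-FPF W (positive-to-front U pos) (λ n → sym (move-to-front Θ v U rest gaps n))
    (sym (length-insert U v rest))

-- The rearrangement of case (3b): for even a, a U (a−1) ⋯ ≈ a (a+1) U ⋯ when U ≥ a+1.
ladder-FPF : ∀ {z t} U rest → All (λ u → suc (suc (suc (t * 2))) ≤ u) U →
  IsFPFWord z (suc (suc (t * 2)) ∷ U ++ suc (t * 2) ∷ rest) →
  IsFPFWord z (suc (suc (t * 2)) ∷ suc (suc (suc (t * 2))) ∷ U ++ rest)
ladder-FPF {t = t} U rest gaps W@(posA ∷ pos , _) =
  same-length-FPF W (posA ∷ s≤s z≤n ∷ positive-remove U pos)
    (λ n → sym (trans (move-to-front (conjBy Θ (suc (suc (t * 2)))) (suc (t * 2)) U rest gaps n)
                      (conjAll-cong (U ++ rest) (fpf-relation t) n)))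
    (cong suc (sym (length-insert U _ rest)))

-- An entry of a Q-tableau: the number of the factor that created the box, and
-- whether it is primed (created by a column insertion).
QEntry : Set
QEntry = ℕ × Bool

above-head : ∀ {x xs} → Linked _<_ (x ∷ xs) → All (x <_) xs
above-head x↗xs with Linked⇒AllPairs <-trans x↗xs
... | x<xs ∷ _ = x<xs

step-eq : ∀ i P Q a {P' r pr} → insertP P a ≡ (P' , r , pr) → step i (P , Q) a ≡ (P' , appendAt Q r (i , pr))
step-eq i P Q a e rewrite e = refl

findRow-none : ∀ {x} L → All (_< x) L → findRow x L ≡ nothing
findRow-none [] [] = refl
findRow-none (b ∷ L) (b<x ∷ L<x) rewrite ≤ᵇ-false b<x | findRow-none L L<x = refl

entryAt-mid : ∀ (pre : List ℕ) y ys → entryAt (pre ++ y ∷ ys) (length pre) ≡ just y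
entryAt-mid [] y ys = refl
entryAt-mid (x ∷ pre) y ys = entryAt-mid pre y ys

entryAt-end : ∀ (pre : List ℕ) → entryAt pre (length pre) ≡ nothing
entryAt-end [] = refl
entryAt-end (x ∷ pre) = entryAt-end pre

setAt-mid : ∀ (pre : List ℕ) y ys x → setAt (pre ++ y ∷ ys) (length pre) x ≡ pre ++ x ∷ ys
setAt-mid [] y ys x = refl
setAt-mid (p ∷ pre) y ys x = cong (p ∷_) (setAt-mid pre y ys x)

-- Column insertion of x into column |pre| of the one-row tableau pre ++ ys, with
-- x ys increasing: every entry of ys is bumped one column to the right, and the
-- insertion ends with a new primed box at the end of row 0.
cascade : ∀ n pre x ys → length ys < n → Linked _<_ (x ∷ ys) →
  insCol n x (length pre) ((pre ++ ys) ∷ []) ≡ ((pre ++ x ∷ ys) ∷ [] , 0 , true)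
cascade (suc n) pre x [] _ _ rewrite ++-identityʳ pre | entryAt-end pre = refl
cascade (suc n) pre x (y ∷ ys) (s≤s fuel-ok) (x<y ∷ y↗ys)
  rewrite entryAt-mid pre y ys | ≤ᵇ-true (<⇒≤ x<y) | ≡ᵇ-false (<⇒≢ x<y) | setAt-mid pre y ys x =
  trans (cong₂ (λ col row → insCol n y col (row ∷ [])) (sym next-column) (sym (++-assoc pre (x ∷ []) ys)))
    (trans (cascade n (pre ++ x ∷ []) y ys fuel-ok y↗ys)
           (cong (λ row → row ∷ [] , 0 , true) (++-assoc pre (x ∷ []) (y ∷ ys))))
  where
    next-column : length (pre ++ x ∷ []) ≡ suc (length pre)
    next-column = trans (length-++ pre) (+-comm (length pre) 1)

fuel-bound : ∀ (row : List ℕ) → length row < fuel (row ∷ [])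
fuel-bound row = s≤s (≤-trans (≤-trans (≤-trans (m≤m+n _ 0) (m≤m+n _ 1)) (m≤n*m _ 3)) (m≤n+m _ 4))

-- Q-entries produced by row insertions of the letters of xs during factor i.
labels : ℕ → List ℕ → List QEntry
labels i = map (λ _ → (i , false))

append-larger : ∀ {x} row → All (_< x) row → insertP (row ∷ []) x ≡ ((row ++ x ∷ []) ∷ [] , 0 , false)
append-larger row row<x rewrite findRow-none row row<x = refl

insert-increasing : ∀ i row q ys → All (λ y → All (_< y) row) ys → Linked _<_ ys →
  foldl (step i) (row ∷ [] , q ∷ []) ys ≡ ((row ++ ys) ∷ [] , (q ++ labels i ys) ∷ [])
insert-increasing i row q [] _ _ rewrite ++-identityʳ row | ++-identityʳ q = refl
insert-increasing i row q (y ∷ ys) (row<y ∷ row<ys) inc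
  rewrite step-eq i (row ∷ []) (q ∷ []) y (append-larger row row<y) =
  trans (insert-increasing i (row ++ y ∷ []) (q ++ (i , false) ∷ []) ys row'<ys (Linked.tail inc))
    (cong₂ (λ r q' → r ∷ [] , q' ∷ []) (++-assoc row (y ∷ []) ys) (++-assoc q ((i , false) ∷ []) (labels i ys)))
  where
    row'<ys : All (λ y' → All (_< y') (row ++ y ∷ [])) ys
    row'<ys = All.zipWith (λ { (r<y' , y<y') → AllP.++⁺ r<y' (y<y' ∷ []) }) (row<ys , above-head inc)

insert-first-factor : ∀ i u us → Linked _<_ (u ∷ us) →
  foldl (step i) ([] , []) (u ∷ us) ≡ ((u ∷ us) ∷ [] , ((i , false) ∷ labels i us) ∷ [])
insert-first-factor i u us inc =
  insert-increasing i (u ∷ []) ((i , false) ∷ []) us (All.map (λ u<y → u<y ∷ []) (above-head inc)) (Linked.tail inc)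

parity-flip : ∀ x → (x % 2 ≡ᵇ suc x % 2) ≡ false
parity-flip x with parity x
... | inj₁ (t , refl) rewrite m*n%n≡0 t 2 {{_}} | odd%2 t = refl
... | inj₂ (t , refl) rewrite odd%2 t | m*n%n≡0 (suc t) 2 {{_}} = refl

-- A letter x < u of the same parity as the head u of an increasing row takes the
-- diagonal place of u (rule (3)); u then cascades along the columns.
insert-below-head : ∀ x u us → x < u → (x % 2 ≡ᵇ u % 2) ≡ true → Linked _<_ (u ∷ us) →
  insertP ((u ∷ us) ∷ []) x ≡ ((x ∷ u ∷ us) ∷ [] , 0 , true)
insert-below-head x u us x<u same-parity inc
  rewrite ≤ᵇ-true (<⇒≤ x<u) | ≡ᵇ-false (<⇒≢ x<u) | same-parity =
  cascade _ (x ∷ []) u us (s<s⁻¹ (fuel-bound (u ∷ us))) inc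

-- The predecessor x of the head of a row has the other parity (rule (2)): the
-- row keeps its head and x+2 cascades from column 1.
insert-predecessor : ∀ x us → Linked _<_ (suc (suc x) ∷ us) →
  insertP ((suc x ∷ us) ∷ []) x ≡ ((suc x ∷ suc (suc x) ∷ us) ∷ [] , 0 , true)
insert-predecessor x us inc rewrite ≤ᵇ-true (n≤1+n x) | ≡ᵇ-false (n≢1+n x) | parity-flip x =
  cascade _ (suc x ∷ []) (suc (suc x)) us (s<s⁻¹ (fuel-bound (suc x ∷ us))) inc

-- Inserting the head u of a row again (rule (1)) creates the second row u+1.
insert-equal-head : ∀ u us → insertP ((u ∷ us) ∷ []) u ≡ ((u ∷ us) ∷ (suc u ∷ []) ∷ [] , 1 , false)
insert-equal-head u us rewrite ≤ᵇ-true (≤-refl {u}) | ≡ᵇ-refl u = refl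

DifferAt : List QEntry → QEntry → QEntry → QTab → QTab → Set
DifferAt A x y Q Q' =
  Σ (List QEntry) λ B → Σ QTab λ rows → Q ≡ (A ++ x ∷ B) ∷ rows × Q' ≡ (A ++ y ∷ B) ∷ rows

differAt-append : ∀ {A x y Q Q'} r e → DifferAt A x y Q Q' → DifferAt A x y (appendAt Q r e) (appendAt Q' r e)
differAt-append {A} {x} {y} zero e (B , rows , refl , refl) =
  B ++ e ∷ [] , rows , cong (_∷ rows) (++-assoc A (x ∷ B) (e ∷ [])) , cong (_∷ rows) (++-assoc A (y ∷ B) (e ∷ []))
differAt-append (suc r) e (B , rows , refl , refl) = B , appendAt rows r e , refl , refl

Related : List QEntry → QEntry → QEntry → Tab × QTab → Tab × QTab → Set
Related A x y S S' = proj₁ S ≡ proj₁ S' × DifferAt A x y (proj₂ S) (proj₂ S')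

-- Insertion only depends on P and only appends to Q, so relatedness persists.
related-step : ∀ {A x y} i S S' a → Related A x y S S' → Related A x y (step i S a) (step i S' a)
related-step i (P , Q) (.P , Q') a (refl , differ) with insertP P a
... | (P' , r , pr) = refl , differAt-append r (i , pr) differ

related-fold : ∀ {A x y} i S S' w → Related A x y S S' → Related A x y (foldl (step i) S w) (foldl (step i) S' w)
related-fold i S S' [] rel = rel
related-fold i S S' (a ∷ w) rel = related-fold i (step i S a) (step i S' a) w (related-step i S S' a rel)

related-goH : ∀ {A x y} i fs S S' → Related A x y S S' → Related A x y (goH i fs S) (goH i fs S')
related-goH i [] S S' rel = rel
related-goH i (u ∷ fs) S S' rel = related-goH (suc i) fs _ _ (related-fold i S S' u rel)

-- Cases (2), (3a), (3b) have one shape: the first letter v of the second factor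
-- moves into the new first factor g¹.
ẽ-moves-first-letter : ∀ {z m} (A : List QEntry) (x y : QEntry) (P : Tab) w¹ v vs g¹ R →
  IsRF m z (g¹ ∷ vs ∷ R) →
  step 2 (foldl (step 1) ([] , []) w¹) v ≡ (P , (A ++ x ∷ []) ∷ []) →
  foldl (step 1) ([] , []) g¹ ≡ (P , (A ++ y ∷ []) ∷ []) →
  (∀ B rows → eP ((A ++ x ∷ B) ∷ rows) ≡ just ((A ++ y ∷ B) ∷ rows)) →
  EFis z m (w¹ ∷ (v ∷ vs) ∷ R) (g¹ ∷ vs ∷ R)
ẽ-moves-first-letter A x y P w¹ v vs g¹ R rf after-v after-g¹ ẽ-acts
  with related-goH 3 R _ _ (related-fold 2 _ _ vs
         (subst₂ (Related A x y) (sym after-v) (sym after-g¹) (refl , [] , [] , refl , refl)))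
... | same-P , B , rows , Q-f , Q-g =
  rf , proj₂ (HSp (g¹ ∷ vs ∷ R)) ,
  trans (cong eP Q-f) (trans (ẽ-acts B rows) (cong just (sym Q-g))) ,
  cong (_, proj₂ (HSp (g¹ ∷ vs ∷ R))) (sym same-P)

fix2'-after-ones : ∀ us B → fix2' (labels 1 us ++ (2 , true) ∷ B) ≡ just (labels 1 us ++ (1 , false) ∷ B)
fix2'-after-ones [] B = refl
fix2'-after-ones (u ∷ us) B rewrite fix2'-after-ones us B = refl

eP-primed-two : ∀ us B rows → eP ((((1 , false) ∷ labels 1 us) ++ (2 , true) ∷ B) ∷ rows)
                            ≡ just ((((1 , false) ∷ labels 1 us) ++ (1 , false) ∷ B) ∷ rows)
eP-primed-two us B rows rewrite fix2'-after-ones us B = refl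

-- A row 0 of Q on which ẽ^P cannot act: no unprimed 2 at its head, no primed 2 after it.
Inert : List QEntry → Set
Inert [] = ⊤
Inert (e ∷ es) = e ≢ (2 , false) × All (_≢ (2 , true)) es

fix2'-none : ∀ es → All (_≢ (2 , true)) es → fix2' es ≡ nothing
fix2'-none [] [] = refl
fix2'-none ((n , p) ∷ es) (e≢2' ∷ es≢2') with n ≟ 2
... | no n≢2 rewrite ≡ᵇ-false n≢2 | fix2'-none es es≢2' = refl
... | yes refl with p
...   | true = ⊥-elim (e≢2' refl)
...   | false rewrite fix2'-none es es≢2' = refl

inert⇒zero : ∀ Q → Inert (rowAt Q 0) → eP Q ≡ nothing
inert⇒zero [] _ = refl
inert⇒zero ([] ∷ rows) _ = refl
inert⇒zero (((n , p) ∷ rest) ∷ rows) (e≢2 , rest≢2') with n ≟ 2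
... | no n≢2 rewrite ≡ᵇ-false n≢2 | fix2'-none rest rest≢2' = refl
... | yes refl with p
...   | false = ⊥-elim (e≢2 refl)
...   | true rewrite fix2'-none rest rest≢2' = refl

rowAt-append : ∀ (Q : QTab) r e → (rowAt (appendAt Q r e) 0 ≡ rowAt Q 0) ⊎ (rowAt (appendAt Q r e) 0 ≡ rowAt Q 0 ++ e ∷ [])
rowAt-append [] r e = inj₂ refl
rowAt-append (row ∷ Q) zero e = inj₂ refl
rowAt-append (row ∷ Q) (suc r) e = inj₁ refl

inert-snoc : ∀ L e → Inert L → e ≢ (2 , true) → e ≢ (2 , false) → Inert (L ++ e ∷ [])
inert-snoc [] e _ e≢2' e≢2 = e≢2 , []
inert-snoc (l ∷ L) e (l≢2 , L≢2') e≢2' _ = l≢2 , AllP.++⁺ L≢2' (e≢2' ∷ [])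

inert-append : ∀ Q r e → Inert (rowAt Q 0) → e ≢ (2 , true) → e ≢ (2 , false) → Inert (rowAt (appendAt Q r e) 0)
inert-append Q r e inert e≢2' e≢2 with rowAt-append Q r e
... | inj₁ same rewrite same = inert
... | inj₂ extended rewrite extended = inert-snoc (rowAt Q 0) e inert e≢2' e≢2

inert-fold : ∀ i S w → i ≢ 2 → Inert (rowAt (proj₂ S) 0) → Inert (rowAt (proj₂ (foldl (step i) S w)) 0)
inert-fold i S [] i≢2 inert = inert
inert-fold i (P , Q) (a ∷ w) i≢2 inert with insertP P a
... | (P' , r , pr) =
  inert-fold i (P' , appendAt Q r (i , pr)) w i≢2
    (inert-append Q r (i , pr) inert (λ e → i≢2 (cong proj₁ e)) (λ e → i≢2 (cong proj₁ e)))

inert-goH : ∀ i fs S → 3 ≤ i → Inert (rowAt (proj₂ S) 0) → Inert (rowAt (proj₂ (goH i fs S)) 0)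
inert-goH i [] S _ inert = inert
inert-goH i (u ∷ fs) S 3≤i inert =
  inert-goH (suc i) fs _ (≤-trans 3≤i (n≤1+n i)) (inert-fold i S u (λ e → <⇒≢ 3≤i (sym e)) inert)

-- Case (3c) keeps P within two rows; row 1 may be empty.
twoRows : List ℕ → List ℕ → Tab
twoRows R0 [] = R0 ∷ []
twoRows R0 (y ∷ ys) = R0 ∷ (y ∷ ys) ∷ []

twoRows-row0 : ∀ R0 R1 → rowAt (twoRows R0 R1) 0 ≡ R0
twoRows-row0 R0 [] = refl
twoRows-row0 R0 (_ ∷ _) = refl

twoRows-row1 : ∀ R0 R1 → rowAt (twoRows R0 R1) 1 ≡ R1
twoRows-row1 R0 [] = refl
twoRows-row1 R0 (_ ∷ _) = refl

twoRows-append0 : ∀ R0 R1 x → appendAt (twoRows R0 R1) 0 x ≡ twoRows (R0 ++ x ∷ []) R1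
twoRows-append0 R0 [] x = refl
twoRows-append0 R0 (_ ∷ _) x = refl

twoRows-append1 : ∀ R0 R1 y → appendAt (twoRows R0 R1) 1 y ≡ twoRows R0 (R1 ++ y ∷ [])
twoRows-append1 R0 [] y = refl
twoRows-append1 R0 (_ ∷ _) y = refl

twoRows-set : ∀ R0 R1 k x → setEntry (twoRows R0 R1) 0 k x ≡ twoRows (setAt R0 k x) R1
twoRows-set R0 [] k x = refl
twoRows-set R0 (_ ∷ _) k x = refl

row0-equal : ∀ n x j T → All (_< suc x) (rowAt T 1) →
  insRowF (suc n) x 0 T (just (suc j , x)) ≡ (appendAt T 1 (suc x) , 1 , false)
row0-equal n x j T R1<1+x rewrite ≡ᵇ-refl x | findRow-none (rowAt T 1) R1<1+x = refl

row0-bump : ∀ n x j b T → x < b → All (_< b) (rowAt T 1) →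
  insRowF (suc n) x 0 T (just (suc j , b)) ≡ (appendAt (setEntry T 0 (suc j) x) 1 b , 1 , false)
row0-bump n x j b [] x<b _ rewrite ≡ᵇ-false (<⇒≢ x<b) = refl
row0-bump n x j b (row ∷ rows) x<b R1<b rewrite ≡ᵇ-false (<⇒≢ x<b) | findRow-none (rowAt rows 0) R1<b = refl

findRow-found : ∀ x L j b → findRow x L ≡ just (j , b) →
  Σ (List ℕ) λ L1 → Σ (List ℕ) λ L2 → L ≡ L1 ++ b ∷ L2 × length L1 ≡ j × All (_< x) L1 × x ≤ b
findRow-found x (c ∷ L) j b found with x ≤ᵇ c in x≤ᵇc
findRow-found x (c ∷ L) .0 .c refl | true = [] , L , refl , refl , [] , ≤ᵇ⇒≤ x c (subst T (sym x≤ᵇc) tt)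
... | false with findRow x L in found'
...   | just (j' , b') with found
...     | refl with findRow-found x L j' b' found'
...       | L1 , L2 , refl , refl , L1<x , x≤b =
  c ∷ L1 , L2 , refl , refl , ≰⇒> (λ x≤c → subst T x≤ᵇc (≤⇒≤ᵇ x≤c)) ∷ L1<x , x≤b

findRow-missing : ∀ x L → findRow x L ≡ nothing → All (_< x) L
findRow-missing x [] _ = []
findRow-missing x (c ∷ L) missing with x ≤ᵇ c in x≤ᵇc
... | true with missing
...   | ()
findRow-missing x (c ∷ L) missing | false with findRow x L in missing'
...   | nothing = ≰⇒> (λ x≤c → subst T x≤ᵇc (≤⇒≤ᵇ x≤c)) ∷ findRow-missing x L missing'
...   | just _ with missing
...     | ()

Sorted : List ℕ → Set
Sorted = AllPairs _<_

sorted-snoc : ∀ L {x} → Sorted L → All (_< x) L → Sorted (L ++ x ∷ [])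
sorted-snoc L sorted L<x = AllPairsP.++⁺ sorted ([] ∷ []) (All.map (_∷ []) L<x)

sorted-replace : ∀ pre {b x L2} → Sorted (pre ++ b ∷ L2) → All (_< x) pre → x < b → Sorted (pre ++ x ∷ L2)
sorted-replace [] (b<L2 ∷ sorted) [] x<b = All.map (<-trans x<b) b<L2 ∷ sorted
sorted-replace (q ∷ pre) (q<· ∷ sorted) (q<x ∷ pre<x) x<b with AllP.++⁻ pre q<·
... | q<pre , (_ ∷ q<L2) = AllP.++⁺ q<pre (q<x ∷ q<L2) ∷ sorted-replace pre sorted pre<x x<b

sorted-after : ∀ pre {b L2} → Sorted (pre ++ b ∷ L2) → All (b <_) L2
sorted-after [] (b<L2 ∷ _) = b<L2
sorted-after (q ∷ pre) (_ ∷ sorted) = sorted-after pre sorted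

middle : ∀ {P : ℕ → Set} L1 {b L2} → All P (L1 ++ b ∷ L2) → P b × All P L2
middle L1 all with AllP.++⁻ʳ L1 all
... | Pb ∷ PL2 = Pb , PL2

-- Row 1 lies below every entry of row 0 that later letters (all > p) can reach,
-- or is entirely ≤ p+1.
Below : List ℕ → List ℕ → ℕ → Set
Below R0 R1 p = All (λ m → All (λ e → p < e → m < e) R0) R1 ⊎ All (_≤ suc p) R1

-- Invariant of case (3c) after inserting the letter p of the second factor:
-- row 0 is increasing with head ≤ p (so no later letter reaches the diagonal).
Inv : List ℕ → List ℕ → ℕ → Set
Inv R0 R1 p = Σ ℕ λ r0 → Σ (List ℕ) λ rest → R0 ≡ r0 ∷ rest × r0 ≤ p × Sorted R0 × Below R0 R1 p

RowStep : List ℕ → List ℕ → ℕ → Set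
RowStep R0 R1 x = Σ (List ℕ) λ R0' → Σ (List ℕ) λ R1' → Σ ℕ λ r →
  insertP (twoRows R0 R1) x ≡ (twoRows R0' R1' , r , false) × Inv R0' R1' x

append-case : ∀ r0 rest R1 p x → r0 ≤ p → Sorted (r0 ∷ rest) → p < x → findRow x rest ≡ nothing →
  RowStep (r0 ∷ rest) R1 x
append-case r0 rest R1 p x r0≤p sorted p<x missing =
  r0 ∷ rest ++ x ∷ [] , R1 , 0 ,
  trans (cong (insRowF _ x 0 (twoRows (r0 ∷ rest) R1)) none-larger)
        (cong (λ T → T , 0 , false) (twoRows-append0 (r0 ∷ rest) R1 x)) ,
  (r0 , rest ++ x ∷ [] , refl , ≤-trans r0≤p (<⇒≤ p<x) , sorted-snoc (r0 ∷ rest) sorted row<x ,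
   inj₁ (All.universal (λ _ → nothing-above) R1))
  where
    r0<x : r0 < x
    r0<x = ≤-<-trans r0≤p p<x
    row<x : All (_< x) (r0 ∷ rest)
    row<x = r0<x ∷ findRow-missing x rest missing
    none-larger : findRow x (rowAt (twoRows (r0 ∷ rest) R1) 0) ≡ nothing
    none-larger rewrite twoRows-row0 (r0 ∷ rest) R1 | ≤ᵇ-false r0<x | missing = refl
    nothing-above : ∀ {m} → All (λ e → x < e → m < e) ((r0 ∷ rest) ++ x ∷ [])
    nothing-above = All.map (λ e≤x x<e → ⊥-elim (<⇒≱ x<e e≤x)) (AllP.++⁺ (All.map <⇒≤ row<x) (≤-refl ∷ []))

equal-case : ∀ r0 L1 L2 R1 p x → r0 ≤ p → Sorted (r0 ∷ L1 ++ x ∷ L2) → Below (r0 ∷ L1 ++ x ∷ L2) R1 p →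
  p < x → findRow x (L1 ++ x ∷ L2) ≡ just (length L1 , x) → RowStep (r0 ∷ L1 ++ x ∷ L2) R1 x
equal-case r0 L1 L2 R1 p x r0≤p sorted below p<x found =
  R0 , R1 ++ suc x ∷ [] , 1 ,
  trans (cong (insRowF _ x 0 (twoRows R0 R1)) found-x)
    (trans (row0-equal _ x (length L1) (twoRows R0 R1) (subst (All (_< suc x)) (sym (twoRows-row1 R0 R1)) R1<1+x))
           (cong (λ T → T , 1 , false) (twoRows-append1 R0 R1 (suc x)))) ,
  (r0 , L1 ++ x ∷ L2 , refl , ≤-trans r0≤p (<⇒≤ p<x) , sorted ,
   inj₂ (AllP.++⁺ (All.map <⇒≤ R1<1+x) (≤-refl ∷ [])))
  where
    R0 : List ℕ
    R0 = r0 ∷ L1 ++ x ∷ L2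
    found-x : findRow x (rowAt (twoRows R0 R1) 0) ≡ just (suc (length L1) , x)
    found-x rewrite twoRows-row0 R0 R1 | ≤ᵇ-false (≤-<-trans r0≤p p<x) | found = refl
    R1<1+x : All (_< suc x) R1
    R1<1+x = [ (λ under → All.map (λ m<R0 → ≤-trans (proj₁ (middle (r0 ∷ L1) m<R0) p<x) (n≤1+n x)) under)
             , (λ ≤1+p → All.map (λ m≤1+p → s≤s (≤-trans m≤1+p p<x)) ≤1+p) ]′ below

below-from : ∀ pre b L2 R1 p → Sorted (pre ++ b ∷ L2) → Below (pre ++ b ∷ L2) R1 p → suc p < b →
  All (λ m → All (m <_) (b ∷ L2)) R1
below-from pre b L2 R1 p sorted below 1+p<b =
  [ (λ under → All.map (λ m<R0 → proj₁ (middle pre m<R0) p<b ∷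
                                 All.zipWith (λ { (reach , b<e) → reach (<-trans p<b b<e) })
                                             (proj₂ (middle pre m<R0) , b<L2)) under)
  , (λ ≤1+p → All.map (λ m≤1+p → All.map (≤-<-trans m≤1+p) (1+p<b ∷ All.map (<-trans 1+p<b) b<L2)) ≤1+p) ]′ below
  where
    p<b : p < b
    p<b = <-trans (n<1+n p) 1+p<b
    b<L2 : All (b <_) L2
    b<L2 = sorted-after pre sorted

bump-case : ∀ r0 L1 b L2 R1 p x → r0 ≤ p → Sorted (r0 ∷ L1 ++ b ∷ L2) → Below (r0 ∷ L1 ++ b ∷ L2) R1 p →
  p < x → All (_< x) L1 → x < b → findRow x (L1 ++ b ∷ L2) ≡ just (length L1 , b) →
  RowStep (r0 ∷ L1 ++ b ∷ L2) R1 x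
bump-case r0 L1 b L2 R1 p x r0≤p sorted below p<x L1<x x<b found =
  r0 ∷ L1 ++ x ∷ L2 , R1 ++ b ∷ [] , 1 ,
  trans (cong (insRowF _ x 0 (twoRows R0 R1)) found-b)
    (trans (row0-bump _ x (length L1) b (twoRows R0 R1) x<b (subst (All (_< b)) (sym (twoRows-row1 R0 R1)) R1<b))
      (cong (λ T → T , 1 , false) new-tableau)) ,
  (r0 , L1 ++ x ∷ L2 , refl , ≤-trans r0≤p (<⇒≤ p<x) ,
   sorted-replace (r0 ∷ L1) sorted (r0<x ∷ L1<x) x<b ,
   inj₁ (AllP.++⁺ (All.map below-new-row0 R1<L2) (below-new-row0 (sorted-after (r0 ∷ L1) sorted) ∷ [])))
  where
    R0 : List ℕ
    R0 = r0 ∷ L1 ++ b ∷ L2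
    r0<x : r0 < x
    r0<x = ≤-<-trans r0≤p p<x
    p<b : p < b
    p<b = <-trans p<x x<b
    found-b : findRow x (rowAt (twoRows R0 R1) 0) ≡ just (suc (length L1) , b)
    found-b rewrite twoRows-row0 R0 R1 | ≤ᵇ-false r0<x | found = refl
    new-tableau : appendAt (setEntry (twoRows R0 R1) 0 (suc (length L1)) x) 1 b ≡ twoRows (r0 ∷ L1 ++ x ∷ L2) (R1 ++ b ∷ [])
    new-tableau = trans (cong (λ T → appendAt T 1 b) (twoRows-set R0 R1 (suc (length L1)) x))
                   (trans (twoRows-append1 (setAt R0 (suc (length L1)) x) R1 b)
                          (cong (λ row → twoRows (r0 ∷ row) (R1 ++ b ∷ [])) (setAt-mid L1 b L2 x)))
    R1<b⋯ : All (λ m → All (m <_) (b ∷ L2)) R1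
    R1<b⋯ = below-from (r0 ∷ L1) b L2 R1 p sorted below (≤-<-trans p<x x<b)
    R1<b : All (_< b) R1
    R1<b = All.map All.head R1<b⋯
    R1<L2 : All (λ m → All (m <_) L2) R1
    R1<L2 = All.map All.tail R1<b⋯
    below-new-row0 : ∀ {m} → All (m <_) L2 → All (λ e → x < e → m < e) (r0 ∷ L1 ++ x ∷ L2)
    below-new-row0 m<L2 = (λ x<r0 → ⊥-elim (<-asym r0<x x<r0)) ∷
      AllP.++⁺ (All.map (λ e<x x<e → ⊥-elim (<-asym e<x x<e)) L1<x)
               ((λ x<x → ⊥-elim (<-irrefl refl x<x)) ∷ All.map (λ m<e _ → m<e) m<L2)

row-step : ∀ R0 R1 p x → Inv R0 R1 p → p < x → RowStep R0 R1 x
row-step .(r0 ∷ rest) R1 p x (r0 , rest , refl , r0≤p , sorted , below) p<x with findRow x rest in found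
... | nothing = append-case r0 rest R1 p x r0≤p sorted p<x found
... | just (j , b) with findRow-found x rest j b found
...   | L1 , L2 , refl , refl , L1<x , x≤b with x ≟ b
...     | yes refl = equal-case r0 L1 L2 R1 p x r0≤p sorted below p<x found
...     | no x≢b = bump-case r0 L1 b L2 R1 p x r0≤p sorted below p<x L1<x (≤∧≢⇒< x≤b x≢b) found

InertRow0 : QTab → Set
InertRow0 Q = Σ QEntry λ e → Σ (List QEntry) λ es → rowAt Q 0 ≡ e ∷ es × Inert (e ∷ es)

inertRow0-append : ∀ Q r → InertRow0 Q → InertRow0 (appendAt Q r (2 , false))
inertRow0-append Q r (e , es , row0 , e≢2 , es≢2') with rowAt-append Q r (2 , false)
... | inj₁ same = e , es , trans same row0 , e≢2 , es≢2'
... | inj₂ extended = e , es ++ (2 , false) ∷ [] , trans extended (cong (_++ (2 , false) ∷ []) row0) , e≢2 ,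
                      AllP.++⁺ es≢2' ((λ ()) ∷ [])

inertRow0⇒inert : ∀ Q → InertRow0 Q → Inert (rowAt Q 0)
inertRow0⇒inert Q (e , es , row0 , inert) rewrite row0 = inert

-- In case (3c) each further letter of the second factor ends in a row insertion,
-- adding only unprimed 2's behind the nonempty inert row 0.
insert-rest-inert : ∀ xs R0 R1 p Q → Inv R0 R1 p → All (p <_) xs → Sorted xs → InertRow0 Q →
  InertRow0 (proj₂ (foldl (step 2) (twoRows R0 R1 , Q) xs))
insert-rest-inert [] R0 R1 p Q _ _ _ inert = inert
insert-rest-inert (x ∷ xs) R0 R1 p Q inv (p<x ∷ _) (x<xs ∷ sorted) inert with row-step R0 R1 p x inv p<x
... | R0' , R1' , r , inserted , inv' rewrite step-eq 2 (twoRows R0 R1) Q x inserted =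
  insert-rest-inert xs R0' R1' x (appendAt Q r (2 , false)) inv' x<xs sorted (inertRow0-append Q r inert)

drop-first-iff : ∀ v vs → Linked _<_ (v ∷ vs) → ∀ a → (a ∈ vs) ⇔ ((a ∈ v ∷ vs) × a ≢ v)
drop-first-iff v vs inc a =
  mk⇔ (λ a∈vs → there a∈vs , λ { refl → <⇒≢ (All.lookup (above-head inc) a∈vs) refl })
      (λ { (here a≡v , a≢v) → ⊥-elim (a≢v a≡v) ; (there a∈vs , _) → a∈vs })

add-front-iff : ∀ v (U : List ℕ) a → (a ∈ v ∷ U) ⇔ ((a ∈ U) ⊎ a ≡ v)
add-front-iff v U a = mk⇔ (λ { (here a≡v) → inj₂ a≡v ; (there a∈U) → inj₁ a∈U })
                          (λ { (inj₁ a∈U) → there a∈U ; (inj₂ a≡v) → here a≡v })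

add-second-iff : ∀ u (us : List ℕ) a → (a ∈ u ∷ suc u ∷ us) ⇔ ((a ∈ u ∷ us) ⊎ a ≡ suc u)
add-second-iff u us a =
  mk⇔ (λ { (here a≡u) → inj₁ (here a≡u)
          ; (there (here a≡1+u)) → inj₂ a≡1+u
          ; (there (there a∈us)) → inj₁ (there a∈us) })
      (λ { (inj₁ (here a≡u)) → here a≡u
          ; (inj₁ (there a∈us)) → there (there a∈us)
          ; (inj₂ a≡1+u) → there (here a≡1+u) })

labels-snoc : ∀ i x (xs : List ℕ) → labels i (x ∷ xs) ≡ labels i xs ++ (i , false) ∷ []
labels-snoc i x [] = refl
labels-snoc i x (y ∷ ys) = cong ((i , false) ∷_) (labels-snoc i y ys)

far-above : ∀ {u v} us → suc v < u → Linked _<_ (u ∷ us) → All (λ u' → suc (suc v) ≤ u') (u ∷ us)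
far-above us 1+v<u inc = 1+v<u ∷ All.map (λ u<u' → ≤-trans 1+v<u (<⇒≤ u<u')) (above-head inc)

-- Case (1): with an empty second factor no entry of Q carries the label 2.
case-1 : ∀ f → rowAt f 1 ≡ [] → EFZero f
case-1 [] _ = refl
case-1 (w¹ ∷ []) _ = inert⇒zero (proj₂ (HSp (w¹ ∷ []))) (inert-fold 1 ([] , []) w¹ (λ ()) tt)
case-1 (w¹ ∷ .[] ∷ R) refl =
  inert⇒zero (proj₂ (HSp (w¹ ∷ [] ∷ R)))
    (inert-goH 3 R (foldl (step 1) ([] , []) w¹) ≤-refl (inert-fold 1 ([] , []) w¹ (λ ()) tt))

-- Case (2): the first letter v of w² becomes all of w¹; in Q its unprimed 2
-- on the diagonal becomes a 1.
case-2 : ∀ {z m} v vs R → IsRF m z ([] ∷ (v ∷ vs) ∷ R) →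
  ∃₂ λ (w1 w2 : List ℕ) → EFis z m ([] ∷ (v ∷ vs) ∷ R) (w1 ∷ w2 ∷ R) × w1 ≡ v ∷ []
    × (∀ a → (a ∈ w2) ⇔ ((a ∈ v ∷ vs) × a ≢ v))
case-2 v vs R (len , (_ ∷ inc ∷ incR) , W) =
  v ∷ [] , vs ,
  ẽ-moves-first-letter [] (2 , false) (1 , false) ((v ∷ []) ∷ []) [] v vs (v ∷ []) R
    (len , [-] ∷ Linked.tail inc ∷ incR , W) refl refl (λ B rows → refl) ,
  refl , drop-first-iff v vs inc

-- Case (3a) once u and v have the same parity: v moves to the front of w¹; its
-- insertion cascades along row 0 and ends in a primed 2, which becomes a 1.
case-3a-same-parity : ∀ {z m} u us v vs R → IsRF m z ((u ∷ us) ∷ (v ∷ vs) ∷ R) → suc v < u →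
  (v % 2 ≡ᵇ u % 2) ≡ true → EFis z m ((u ∷ us) ∷ (v ∷ vs) ∷ R) ((v ∷ u ∷ us) ∷ vs ∷ R)
case-3a-same-parity u us v vs R (len , (inc₁ ∷ inc₂ ∷ incR) , W) 1+v<u same-parity =
  ẽ-moves-first-letter A (2 , true) (1 , false) ((v ∷ u ∷ us) ∷ []) (u ∷ us) v vs (v ∷ u ∷ us) R
    (len , (v<u ∷ inc₁) ∷ Linked.tail inc₂ ∷ incR , front-FPF v (u ∷ us) _ (far-above us 1+v<u inc₁) W)
    (trans (cong (λ S → step 2 S v) (insert-first-factor 1 u us inc₁))
           (step-eq 2 ((u ∷ us) ∷ []) (A ∷ []) v (insert-below-head v u us v<u same-parity inc₁)))
    (trans (insert-first-factor 1 v (u ∷ us) (v<u ∷ inc₁))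
           (cong (λ q → (v ∷ u ∷ us) ∷ [] , ((1 , false) ∷ q) ∷ []) (labels-snoc 1 u us)))
    (eP-primed-two us)
  where
    A : List QEntry
    A = (1 , false) ∷ labels 1 us
    v<u : v < u
    v<u = <-trans (n<1+n v) 1+v<u

even-parity : ∀ t t' → (t' * 2 % 2 ≡ᵇ t * 2 % 2) ≡ true
even-parity t t' rewrite m*n%n≡0 t' 2 {{_}} | m*n%n≡0 t 2 {{_}} = refl

-- Case (3a): u is even (first letter), v cannot be odd (it would commute to the
-- front), so both are even.
case-3a : ∀ {z m} u us v vs R → IsRF m z ((u ∷ us) ∷ (v ∷ vs) ∷ R) → suc v < u →
  EFform z m ((u ∷ us) ∷ (v ∷ vs) ∷ R) (λ a → (a ∈ u ∷ us) ⊎ a ≡ v) (λ a → (a ∈ v ∷ vs) × a ≢ v)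
case-3a u us v vs R rf@(_ , (inc₁ ∷ inc₂ ∷ _) , W) 1+v<u with parity u | parity v
... | inj₂ (t , refl) | _ = ⊥-elim (odd-letter-redundant {t = t} [] _ [] W)
... | inj₁ (t , refl) | inj₂ (t' , refl) = ⊥-elim (odd-letter-redundant {t = t'} (t * 2 ∷ us) _ (far-above us 1+v<u inc₁) W)
... | inj₁ (t , refl) | inj₁ (t' , refl) =
  t' * 2 ∷ t * 2 ∷ us , vs , case-3a-same-parity (t * 2) us (t' * 2) vs R rf 1+v<u (even-parity t t') ,
  add-front-iff (t' * 2) (t * 2 ∷ us) , drop-first-iff (t' * 2) vs inc₂

-- In case (3b), with a = u₁ even, w¹ cannot continue with a+1 (ladder-redundant).
skip-successor : ∀ {z t} us rest → Linked _<_ (suc (suc (t * 2)) ∷ us) →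
  IsFPFWord z (suc (suc (t * 2)) ∷ us ++ suc (t * 2) ∷ rest) → Linked _<_ (suc (suc (suc (t * 2))) ∷ us)
skip-successor [] rest _ _ = [-]
skip-successor {t = t} (u ∷ us) rest (a<u ∷ inc) W with u ≟ suc (suc (suc (t * 2)))
... | yes refl = ⊥-elim (ladder-redundant {t = t} us rest (All.map <⇒≤ (above-head inc)) W)
... | no u≢1+a = ≤∧≢⇒< a<u (≢-sym u≢1+a) ∷ inc

-- Case (3b) with v = 2t+1 odd and u = v+1: w¹ gains u+1; the insertion of v
-- keeps the head u (rule (2)) and ends in a primed 2, which becomes a 1.
case-3b-odd : ∀ {z m} t us vs R → IsRF m z ((suc (suc (t * 2)) ∷ us) ∷ (suc (t * 2) ∷ vs) ∷ R) →
  EFis z m ((suc (suc (t * 2)) ∷ us) ∷ (suc (t * 2) ∷ vs) ∷ R)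
           ((suc (suc (t * 2)) ∷ suc (suc (suc (t * 2))) ∷ us) ∷ vs ∷ R)
case-3b-odd t us vs R (len , (inc₁ ∷ inc₂ ∷ incR) , W) =
  ẽ-moves-first-letter A (2 , true) (1 , false) ((a ∷ suc a ∷ us) ∷ []) (a ∷ us) c vs
    (a ∷ suc a ∷ us) R
    (len , (n<1+n a ∷ inc₁') ∷ Linked.tail inc₂ ∷ incR , ladder-FPF {t = t} us _ (above-head inc₁) W)
    (trans (cong (λ S → step 2 S c) (insert-first-factor 1 a us inc₁))
           (step-eq 2 ((a ∷ us) ∷ []) (A ∷ []) c (insert-predecessor c us inc₁')))
    (trans (insert-first-factor 1 a (suc a ∷ us) (n<1+n a ∷ inc₁'))
           (cong (λ q → (a ∷ suc a ∷ us) ∷ [] , ((1 , false) ∷ q) ∷ []) (labels-snoc 1 (suc a) us)))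
    (eP-primed-two us)
  where
    c a : ℕ
    c = suc (t * 2)
    a = suc c
    A : List QEntry
    A = (1 , false) ∷ labels 1 us
    inc₁' : Linked _<_ (suc a ∷ us)
    inc₁' = skip-successor {t = t} us (vs ++ concat R) inc₁ W

-- Case (3b): v must be odd, since u = v+1 is the (even) first letter.
case-3b : ∀ {z m} u us v vs R → IsRF m z ((u ∷ us) ∷ (v ∷ vs) ∷ R) → u ≡ suc v →
  EFform z m ((u ∷ us) ∷ (v ∷ vs) ∷ R) (λ a → (a ∈ u ∷ us) ⊎ a ≡ suc u) (λ a → (a ∈ v ∷ vs) × a ≢ u ∸ 1)
case-3b .(suc v) us v vs R rf@(_ , (_ ∷ inc₂ ∷ _) , W) refl with parity v
... | inj₁ (t , refl) = ⊥-elim (odd-letter-redundant {t = t} [] _ [] W)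
... | inj₂ (t , refl) =
  suc (suc (t * 2)) ∷ suc (suc (suc (t * 2))) ∷ us , vs , case-3b-odd t us vs R rf ,
  add-second-iff (suc (suc (t * 2))) us , drop-first-iff (suc (t * 2)) vs inc₂

-- Case (3c): the second factor only adds unprimed 2's behind the row of 1's
-- (first possibly sending u+1 to row 1), so ẽ^P finds nothing.
case-3c : ∀ u us v vs R → Linked _<_ (u ∷ us) → Linked _<_ (v ∷ vs) → u ≤ v → EFZero ((u ∷ us) ∷ (v ∷ vs) ∷ R)
case-3c u us v vs R inc₁ inc₂ u≤v =
  inert⇒zero (proj₂ (HSp ((u ∷ us) ∷ (v ∷ vs) ∷ R))) (inert-goH 3 R S₂ ≤-refl (inertRow0⇒inert (proj₂ S₂)
    (subst (λ S → InertRow0 (proj₂ (foldl (step 2) S (v ∷ vs)))) (sym (insert-first-factor 1 u us inc₁)) second-factor)))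
  where
    A : List QEntry
    A = (1 , false) ∷ labels 1 us
    S₂ : Tab × QTab
    S₂ = foldl (step 2) (foldl (step 1) ([] , []) (u ∷ us)) (v ∷ vs)
    ones : InertRow0 (A ∷ [])
    ones = (1 , false) , labels 1 us , refl , (λ ()) , AllP.map⁺ (All.universal (λ _ ()) us)
    second-factor : InertRow0 (proj₂ (foldl (step 2) ((u ∷ us) ∷ [] , A ∷ []) (v ∷ vs)))
    second-factor with v ≟ u
    ... | yes refl rewrite step-eq 2 ((v ∷ us) ∷ []) (A ∷ []) v (insert-equal-head v us) =
      insert-rest-inert vs (v ∷ us) (suc v ∷ []) v (appendAt (A ∷ []) 1 (2 , false))
        (v , us , refl , ≤-refl , Linked⇒AllPairs <-trans inc₁ , inj₂ (≤-refl ∷ []))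
        (above-head inc₂) (Linked⇒AllPairs <-trans (Linked.tail inc₂)) (inertRow0-append (A ∷ []) 1 ones)
    ... | no v≢u =
      insert-rest-inert (v ∷ vs) (u ∷ us) [] u (A ∷ [])
        (u , us , refl , ≤-refl , Linked⇒AllPairs <-trans inc₁ , inj₁ [])
        (u<v ∷ All.map (<-trans u<v) (above-head inc₂)) (Linked⇒AllPairs <-trans inc₂) ones
      where
        u<v : u < v
        u<v = ≤∧≢⇒< u≤v (≢-sym v≢u)

EmptyFirstClaim : (ℕ → ℕ) → ℕ → List (List ℕ) → Set
EmptyFirstClaim z m f =
  rowAt f 0 ≡ [] → (v₁ : ℕ) (vs : List ℕ) → rowAt f 1 ≡ v₁ ∷ vs →
    ∃₂ λ (w1 w2 : List ℕ) → EFis z m f (w1 ∷ w2 ∷ drop 2 f) × w1 ≡ v₁ ∷ []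
      × (∀ a → (a ∈ w2) ⇔ ((a ∈ rowAt f 1) × a ≢ v₁))

BothNonemptyClaim : (ℕ → ℕ) → ℕ → List (List ℕ) → Set
BothNonemptyClaim z m f =
  (u₁ : ℕ) (us : List ℕ) (v₁ : ℕ) (vs : List ℕ) → rowAt f 0 ≡ u₁ ∷ us → rowAt f 1 ≡ v₁ ∷ vs →
    (suc v₁ < u₁ → EFform z m f (λ a → (a ∈ rowAt f 0) ⊎ a ≡ v₁) (λ a → (a ∈ rowAt f 1) × a ≢ v₁))
    × (u₁ ≡ suc v₁ → EFform z m f (λ a → (a ∈ rowAt f 0) ⊎ a ≡ suc u₁)
                                  (λ a → (a ∈ rowAt f 1) × a ≢ u₁ ∸ 1))
    × (u₁ ≤ v₁ → EFZero f)

empty-first : ∀ {z m} f → IsRF m z f → EmptyFirstClaim z m f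
empty-first (.[] ∷ .(v₁ ∷ vs) ∷ R) rf refl v₁ vs refl = case-2 v₁ vs R rf

both-nonempty : ∀ {z m} f → IsRF m z f → BothNonemptyClaim z m f
both-nonempty (.(u₁ ∷ us) ∷ .(v₁ ∷ vs) ∷ R) rf@(_ , (inc₁ ∷ inc₂ ∷ _) , _) u₁ us v₁ vs refl refl =
  case-3a u₁ us v₁ vs R rf , case-3b u₁ us v₁ vs R rf , case-3c u₁ us v₁ vs R inc₁ inc₂

lemma5p4 : (z : ℕ → ℕ) (m : ℕ) (f : List (List ℕ)) → InF∞ z → IsRF m z f →
    (rowAt f 1 ≡ [] → EFZero f)
    × (rowAt f 0 ≡ [] → (v₁ : ℕ) (vs : List ℕ) → rowAt f 1 ≡ v₁ ∷ vs →
         ∃₂ λ (w1 w2 : List ℕ) → EFis z m f (w1 ∷ w2 ∷ drop 2 f) × w1 ≡ v₁ ∷ []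
           × (∀ a → (a ∈ w2) ⇔ ((a ∈ rowAt f 1) × a ≢ v₁)))
    × ((u₁ : ℕ) (us : List ℕ) (v₁ : ℕ) (vs : List ℕ) →
         rowAt f 0 ≡ u₁ ∷ us → rowAt f 1 ≡ v₁ ∷ vs →
         (suc v₁ < u₁ → EFform z m f (λ a → (a ∈ rowAt f 0) ⊎ a ≡ v₁)
                                     (λ a → (a ∈ rowAt f 1) × a ≢ v₁))
         × (u₁ ≡ suc v₁ → EFform z m f (λ a → (a ∈ rowAt f 0) ⊎ a ≡ suc u₁)
                                       (λ a → (a ∈ rowAt f 1) × a ≢ u₁ ∸ 1))
         × (u₁ ≤ v₁ → EFZero f))
lemma5p4 z m f _ rf = case-1 f , empty-first f rf , both-nonempty f rf
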